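{- There is an algorithm which, given as input a graph $G$ of clique-width at most $k$, computes a linear order $<$ on $V(G)$ and a $\{E,<\}$-clique-expression of width at most $2^{k+2}$ generating the structure $(G,<)$.
   Context: Fix a relational signature $\sigma$ whose symbols have arity at most $2$. A $\sigma$-clique-expression of width $k$ is a pair $(T,\lambda)$ where $T$ is a rooted tree with edges directed away from the root and $\lambda$ labels each node by one of: a colour $\mathbf{i}\in\{\mathbf 1,\dots,\mathbf k\}$ (only at leaves), $\oplus$ (nodes with exactly two children), $\mathrm{edge}_{R,i\to j}$ for $R\in\sigma$ and $i,j\in\{1,\dots,k\}$, or $\mathrm{rename}_{i\to j}$ (the latter two at nodes with exactly one child). Each node $t$ generates a $\sigma$-structure $G(t)$ with vertices coloured by $\{\mathbf1,\dots,\mathbf k\}$: a leaf generates a single element of colour $\lambda(t)$; $\oplus$ gives the disjoint union of the structures of the two children; $\mathrm{edge}_{R,i\to j}$ adds to $R$ all pairs $(u,v)$ with $u$ of colour $i$ and $v$ of colour $j$; $\mathrm{rename}_{i\to j}$ recolours all vertices of colour $i$ to colour $j$. The structure generated by $(T,\lambda)$ is $G(r)$ for the root $r$, with colours removed. The clique-width of a $\sigma$-structure is the minimum width of a clique-expression generating it; for graphs the signature is $\{E\}$. -}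

module Defs where

open import Data.Nat using (ℕ; _+_)
open import Data.Fin using (Fin; splitAt; _≟_)
open import Data.Sum using (_⊎_; inj₁; inj₂; [_,_])
open import Data.Product using (Σ; _×_; _,_)
open import Data.Bool using (Bool; true; false)
open import Data.Empty using (⊥)
open import Relation.Nullary using (yes; no)
open import Relation.Binary.PropositionalEquality using (_≡_)
open import Function.Bundles using (_↔_; _⇔_; Inverse)

-- A relational signature all of whose symbols are binary, given by its
-- type of relation symbols S.  (Only the signatures {E} and {E,<} are needed.)

data CE (S : Set) (k : ℕ) : Set where
  leaf   : Fin k → CE S k
  _⊕_    : CE S k → CE S k → CE S k
  edge   : S → Fin k → Fin k → CE S k → CE S k
  rename : Fin k → Fin k → CE S k → CE S k

module _ {S : Set} {k : ℕ} where

  size : CE S k → ℕ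
  size (leaf _)       = 1
  size (e₁ ⊕ e₂)      = size e₁ + size e₂
  size (edge _ _ _ e) = size e
  size (rename _ _ e) = size e

  col : (e : CE S k) → Fin (size e) → Fin k
  col (leaf c)       _ = c
  col (e₁ ⊕ e₂)      u = [ col e₁ , col e₂ ] (splitAt (size e₁) u)
  col (edge _ _ _ e) u = col e u
  col (rename i j e) u with col e u ≟ i
  ... | yes _ = j
  ... | no  _ = col e u

  rel : (e : CE S k) → S → Fin (size e) → Fin (size e) → Set
  rel (leaf _)        R u v = ⊥
  rel (e₁ ⊕ e₂)       R u v with splitAt (size e₁) u | splitAt (size e₁) v
  ... | inj₁ u₁ | inj₁ v₁ = rel e₁ R u₁ v₁
  ... | inj₂ u₂ | inj₂ v₂ = rel e₂ R u₂ v₂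
  ... | inj₁ _  | inj₂ _  = ⊥
  ... | inj₂ _  | inj₁ _  = ⊥
  rel (edge R' i j e) R u v = rel e R u v ⊎ (R ≡ R' × (col e u ≡ i × col e v ≡ j))
  rel (rename _ _ e)  R u v = rel e R u v

record Str (S : Set) : Set₁ where
  field
    n   : ℕ
    Rel : S → Fin n → Fin n → Set

⟦_⟧ : {S : Set} {k : ℕ} → CE S k → Str S
⟦ e ⟧ = record { n = size e ; Rel = rel e }

record _≅_ {S : Set} (A B : Str S) : Set where
  field
    bij  : Fin (Str.n A) ↔ Fin (Str.n B)
    pres : ∀ R u v → Str.Rel A R u v ⇔ Str.Rel B R (Inverse.to bij u) (Inverse.to bij v)

Generates : {S : Set} {k : ℕ} → CE S k → Str S → Set
Generates e A = ⟦ e ⟧ ≅ A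

record Graph : Set where
  field
    n       : ℕ
    adj     : Fin n → Fin n → Bool
    adj-sym : ∀ u v → adj u v ≡ adj v u
    irrefl  : ∀ u → adj u u ≡ false

data SigE : Set where
  E : SigE

data SigE< : Set where
  E' : SigE<
  lt : SigE<

graphStr : Graph → Str SigE
graphStr G = record { n = Graph.n G ; Rel = λ { E u v → Graph.adj G u v ≡ true } }

ordGraphStr : (G : Graph) → (Fin (Graph.n G) → Fin (Graph.n G) → Set) → Str SigE<
ordGraphStr G _<_ = record { n = Graph.n G
                           ; Rel = λ { E' u v → Graph.adj G u v ≡ true ; lt u v → u < v } }

CWAtMost : Graph → ℕ → Set
CWAtMost G k = Σ (CE SigE k) λ e → Generates e (graphStr G)

-- A clique-expression of width k can be normalised so that every leaf and
-- every disjoint union is followed by exactly one batch of edge insertions (a k × k Boolean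
-- matrix on colours) and one simultaneous recolouring (a map on the k colours).  A normal
-- form with N vertices has union depth below N, so there are only finitely many candidates
-- and one generating G is found by exhaustive search; the clique-width hypothesis is
-- irrelevant (it cannot be computed with) and only rules out that the search fails.
-- The order is the left-to-right order of the leaves of the normal form, and it is generated
-- with two copies c₀, c₁ of the k colours: finished subexpressions use c₀; for a union the
-- right operand is moved to c₁, <-edges are added from c₀ to c₁, and c₁ is moved back.
-- Hence 2k ≤ 2^(k+2) colours suffice.
module Submission where

open import Defs
open import Level using (0ℓ)
open import Data.Bool using (Bool; true; false; T; _∧_; _∨_)
import Data.Bool as Bool
open import Data.Bool.Properties using (T-∧; T-∨)
open import Data.Empty using (⊥; ⊥-elim)
import Data.Empty.Irrelevant as Irr
open import Data.Fin as Fin using (Fin; zero; suc; splitAt; _≟_; _↑ˡ_; _↑ʳ_)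
import Data.Fin.Properties as Fin
open import Data.Nat as ℕ using (ℕ; zero; suc; _+_; _^_; _≤_; _<_)
import Data.Nat.Properties as ℕ
open import Data.Product as Product using (Σ; ∃; _×_; _,_; proj₁; proj₂; uncurry)
open import Data.Sum as Sum using (_⊎_; inj₁; inj₂; [_,_]′)
open import Data.Sum.Algebra using (⊎-assoc)
open import Data.Sum.Function.Propositional using (_⊎-⇔_; _⊎-↔_)
open import Data.Product.Function.NonDependent.Propositional using (_×-⇔_)
open import Data.Sum.Relation.Binary.LeftOrder as LeftOrder using (_⊎-<_; ₁∼₂; ₁∼₁; ₂∼₂)
open import Data.Sum.Relation.Binary.Pointwise using (Pointwise; inj₁; inj₂; drop-inj₁; drop-inj₂; ⊎-decidable)
open import Data.Maybe using (Maybe; just; nothing)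
import Data.Maybe.Properties as Maybe
import Data.Sum.Properties as Sum
open import Data.List as List using (List; []; _∷_)
open import Data.List.Membership.Propositional using (_∈_)
open import Data.List.Membership.Propositional.Properties using (∈-filter⁺; ∈-filter⁻; ∈-cartesianProduct⁺; ∈-allFin)
open import Data.List.Relation.Unary.Any using (here; there)
open import Data.Vec using (Vec; []; _∷_; lookup; tabulate; map; allFin)
open import Data.Vec.Properties using (lookup∘tabulate; lookup-map)
open import Function using (_∘_; id)
open import Function.Definitions using (Injective)
open import Function.Bundles using (_⇔_; _↔_; mk⇔; mk↔ₛ′; Equivalence; Inverse; Injection)
import Function.Properties.Equivalence as ⇔
open import Function.Properties.Inverse using (↔⇒⇔; ↔⇒↣; ↔-refl; ↔-trans; ↔-sym)
open import Relation.Binary.Definitions using (Trichotomous; tri<; tri≈; tri>) renaming (Decidable to Decidable₂)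
open import Relation.Binary.Structures using (IsStrictTotalOrder)
import Relation.Binary.PropositionalEquality as ≡
open import Relation.Binary.PropositionalEquality using (_≡_; _≢_; refl; sym; trans; cong; subst; subst₂; module ≡-Reasoning)
open import Relation.Nullary using (Dec; yes; no; ¬_)
open import Relation.Nullary.Decidable using (map′; _⊎-dec_; _×-dec_; _→-dec_; ⌊_⌋; toWitness; fromWitness; T?)
open import Relation.Unary using (Pred; Decidable)

private
  variable
    A B : Set
    k d m n w : ℕ

drop-absurdʳ : ¬ B → (A ⊎ B) ⇔ A
drop-absurdʳ ¬b = mk⇔ [ id , ⊥-elim ∘ ¬b ]′ inj₁

_⇔?_ : Dec A → Dec B → Dec (A ⇔ B)
a? ⇔? b? = map′ (λ (f , g) → mk⇔ f g) (λ e → Equivalence.to e , Equivalence.from e) ((a? →-dec b?) ×-dec (b? →-dec a?))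

-- Exhaustive search

Searchable : Set → Set₁
Searchable A = {P : Pred A 0ℓ} → Decidable P → Dec (∃ P)

search-Bool : Searchable Bool
search-Bool P? = map′ [ (true ,_) , (false ,_) ]′ (λ { (true , p) → inj₁ p ; (false , p) → inj₂ p })
                      (P? true ⊎-dec P? false)

search-⊎ : Searchable A → Searchable B → Searchable (A ⊎ B)
search-⊎ search-A search-B P? =
  map′ [ (λ (a , p) → inj₁ a , p) , (λ (b , p) → inj₂ b , p) ]′
       (λ { (inj₁ a , p) → inj₁ (a , p) ; (inj₂ b , p) → inj₂ (b , p) })
       (search-A (P? ∘ inj₁) ⊎-dec search-B (P? ∘ inj₂))

search-Σ : {B : A → Set} → Searchable A → (∀ a → Searchable (B a)) → Searchable (Σ A B)
search-Σ search-A search-B P? =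
  map′ (λ (a , b , p) → (a , b) , p) (λ ((a , b) , p) → a , b , p)
       (search-A λ a → search-B a λ b → P? (a , b))

search-× : Searchable A → Searchable B → Searchable (A × B)
search-× search-A search-B = search-Σ search-A (λ _ → search-B)

search-Vec : Searchable A → ∀ n → Searchable (Vec A n)
search-Vec search-A zero    P? = map′ ([] ,_) (λ { ([] , p) → p }) (P? [])
search-Vec search-A (suc n) P? =
  map′ (λ (x , xs , p) → x ∷ xs , p) (λ { (x ∷ xs , p) → x , xs , p })
       (search-A λ x → search-Vec search-A n λ xs → P? (x ∷ xs))

search-image : Searchable A → (g : A → B) → (∀ b → ∃ λ a → g a ≡ b) → Searchable B
search-image search-A g g-surjective {P} P? =
  map′ (λ (a , p) → g a , p) (λ (b , p) → from b p) (search-A (P? ∘ g))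
  where
  from : ∀ b → P b → ∃ (P ∘ g)
  from b p with g-surjective b
  ... | a , refl = a , p

-- Clique-expressions and sequences of unary operations

recolour : Fin k → Fin k → Fin k → Fin k
recolour i j c with c ≟ i
... | yes _ = j
... | no  _ = c

recolour-source : (i j : Fin k) → recolour i j i ≡ j
recolour-source i j with i ≟ i
... | yes _  = refl
... | no i≢i = ⊥-elim (i≢i refl)

recolour-other : (i j : Fin k) {c : Fin k} → c ≢ i → recolour i j c ≡ c
recolour-other i j {c} c≢i with c ≟ i
... | yes c≡i = ⊥-elim (c≢i c≡i)
... | no  _   = refl

recolourAll : List (Fin k × Fin k) → Fin k → Fin k
recolourAll ps c = List.foldr (uncurry recolour) c ps

col-rename : {S : Set} (i j : Fin k) (e : CE S k) (u : Fin (size e)) → col (rename i j e) u ≡ recolour i j (col e u)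
col-rename i j e u with col e u ≟ i
... | yes _ = refl
... | no  _ = refl

size-positive : {S : Set} (e : CE S k) → 0 < size e
size-positive (leaf _)       = ℕ.s≤s ℕ.z≤n
size-positive (e₁ ⊕ e₂)      = ℕ.<-≤-trans (size-positive e₁) (ℕ.m≤m+n (size e₁) (size e₂))
size-positive (edge _ _ _ e) = size-positive e
size-positive (rename _ _ e) = size-positive e

union-bounds : {S : Set} (e₁ e₂ : CE S k) → size e₁ + size e₂ ≤ suc d → size e₁ ≤ d × size e₂ ≤ d
union-bounds e₁ e₂ ≤1+d =
  ℕ.s≤s⁻¹ (ℕ.<-≤-trans (ℕ.m<m+n (size e₁) (size-positive e₂)) ≤1+d) ,
  ℕ.s≤s⁻¹ (ℕ.<-≤-trans (ℕ.m<n+m (size e₂) (size-positive e₁)) ≤1+d)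

union-not-single : {S : Set} (e₁ e₂ : CE S k) → ¬ (size e₁ + size e₂ ≤ 1)
union-not-single e₁ e₂ ≤1 = ℕ.<⇒≱ (size-positive e₁) (proj₁ (union-bounds e₁ e₂ ≤1))

allPairs : (w : ℕ) → List (Fin w × Fin w)
allPairs w = List.cartesianProduct (List.allFin w) (List.allFin w)

pairsWhere : (Fin w → Fin w → Bool) → List (Fin w × Fin w)
pairsWhere {w} Q = List.filter (λ (x , y) → T? (Q x y)) (allPairs w)

∈-pairsWhere : (Q : Fin w → Fin w → Bool) {x y : Fin w} → (x , y) ∈ pairsWhere Q ⇔ T (Q x y)
∈-pairsWhere {w} Q {x} {y} =
  mk⇔ (proj₂ ∘ ∈-filter⁻ Q? {xs = allPairs w}) (∈-filter⁺ Q? (∈-cartesianProduct⁺ (∈-allFin x) (∈-allFin y)))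
  where Q? = λ ((x , y) : Fin w × Fin w) → T? (Q x y)

data Unary (S : Set) (w : ℕ) : Set where
  edgeᵘ   : S → Fin w → Fin w → Unary S w
  renameᵘ : Fin w → Fin w → Unary S w

module _ {S : Set} where

  infixr 5 _◃_
  _◃_ : List (Unary S w) → CE S w → CE S w
  []                   ◃ X = X
  (edgeᵘ R i j ∷ us)   ◃ X = edge R i j (us ◃ X)
  (renameᵘ i j ∷ us)   ◃ X = rename i j (us ◃ X)

  ◃-vertices : (us : List (Unary S w)) (X : CE S w) → Fin (size (us ◃ X)) ↔ Fin (size X)
  ◃-vertices []                  X = ↔-refl
  ◃-vertices (edgeᵘ _ _ _ ∷ us)  X = ◃-vertices us X
  ◃-vertices (renameᵘ _ _ ∷ us)  X = ◃-vertices us X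

  ◃-vertex : (us : List (Unary S w)) (X : CE S w) → Fin (size (us ◃ X)) → Fin (size X)
  ◃-vertex us X = Inverse.to (◃-vertices us X)

  edges : S → List (Fin w × Fin w) → List (Unary S w)
  edges R = List.map (uncurry (edgeᵘ R))

  renames : List (Fin w × Fin w) → List (Unary S w)
  renames = List.map (uncurry renameᵘ)

  module _ (X : CE S w) where

    col-edges : ∀ R ps (u : Fin (size (edges R ps ◃ X))) →
                col (edges R ps ◃ X) u ≡ col X (◃-vertex (edges R ps) X u)
    col-edges R []            u = refl
    col-edges R ((i , j) ∷ ps) u = col-edges R ps u

    rel-edges : ∀ R ps R′ (u v : Fin (size (edges R ps ◃ X))) →
                let u′ = ◃-vertex (edges R ps) X u
                    v′ = ◃-vertex (edges R ps) X v
                in rel (edges R ps ◃ X) R′ u v ⇔ (rel X R′ u′ v′ ⊎ (R′ ≡ R × (col X u′ , col X v′) ∈ ps))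
    rel-edges R []             R′ u v = ⇔.sym (drop-absurdʳ λ ())
    rel-edges R ((i , j) ∷ ps) R′ u v rewrite col-edges R ps u | col-edges R ps v =
      ⇔.trans (rel-edges R ps R′ u v ⊎-⇔ ⇔.refl) (⇔.trans (↔⇒⇔ (⊎-assoc 0ℓ _ _ _)) (⇔.refl ⊎-⇔ ∈-∷))
      where
      ∈-∷ : ∀ {x y} → ((R′ ≡ R × (x , y) ∈ ps) ⊎ (R′ ≡ R × x ≡ i × y ≡ j))
                    ⇔ (R′ ≡ R × (x , y) ∈ (i , j) ∷ ps)
      ∈-∷ = mk⇔ [ Product.map₂ there , (λ { (R′≡R , refl , refl) → R′≡R , here refl }) ]′
                λ { (R′≡R , here refl) → inj₂ (R′≡R , refl , refl) ; (R′≡R , there p) → inj₁ (R′≡R , p) }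

    rel-edgesWhere : ∀ R Q R′ (u v : Fin (size (edges R (pairsWhere Q) ◃ X))) →
                     let u′ = ◃-vertex (edges R (pairsWhere Q)) X u
                         v′ = ◃-vertex (edges R (pairsWhere Q)) X v
                     in rel (edges R (pairsWhere Q) ◃ X) R′ u v
                        ⇔ (rel X R′ u′ v′ ⊎ (R′ ≡ R × T (Q (col X u′) (col X v′))))
    rel-edgesWhere R Q R′ u v = ⇔.trans (rel-edges R (pairsWhere Q) R′ u v) (⇔.refl ⊎-⇔ (⇔.refl ×-⇔ ∈-pairsWhere Q))

    col-renames : ∀ ps (u : Fin (size (renames ps ◃ X))) →
                  col (renames ps ◃ X) u ≡ recolourAll ps (col X (◃-vertex (renames ps) X u))
    col-renames []             u = refl
    col-renames ((i , j) ∷ ps) u = trans (col-rename i j (renames ps ◃ X) u) (cong (recolour i j) (col-renames ps u))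

    rel-renames : ∀ ps R (u v : Fin (size (renames ps ◃ X))) →
                  rel (renames ps ◃ X) R u v ≡ rel X R (◃-vertex (renames ps) X u) (◃-vertex (renames ps) X v)
    rel-renames []            R u v = refl
    rel-renames ((i , j) ∷ ps) R u v = rel-renames ps R u v

relabel : (Fin m → Fin k) → (Fin m → Fin k) → List (Fin k × Fin k)
relabel g h = List.tabulate λ a → g a , h a

recolourAll-relabel-outside : (g h : Fin m → Fin k) {c : Fin k} → (∀ a → c ≢ g a) → recolourAll (relabel g h) c ≡ c
recolourAll-relabel-outside {m = zero}  g h c∉g = refl
recolourAll-relabel-outside {m = suc m} g h c∉g
  rewrite recolourAll-relabel-outside (g ∘ suc) (h ∘ suc) (c∉g ∘ suc) = recolour-other (g zero) (h zero) (c∉g zero)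

recolourAll-relabel : (g h : Fin m → Fin k) → Injective _≡_ _≡_ g → (∀ a b → h a ≢ g b) →
                      ∀ a → recolourAll (relabel g h) (g a) ≡ h a
recolourAll-relabel g h g-injective h∉g zero
  rewrite recolourAll-relabel-outside (g ∘ suc) (h ∘ suc) (λ a → Fin.0≢1+n ∘ g-injective) = recolour-source (g zero) (h zero)
recolourAll-relabel g h g-injective h∉g (suc a)
  rewrite recolourAll-relabel (g ∘ suc) (h ∘ suc) (Fin.suc-injective ∘ g-injective) (λ a b → h∉g (suc a) (suc b)) a =
  recolour-other (g zero) (h zero) (h∉g (suc a) zero)

-- Normal forms

Matrix : ℕ → Set
Matrix k = Vec (Vec Bool k) k

entry : Matrix k → Fin k → Fin k → Bool
entry S a b = lookup (lookup S a) b

matrix : (Fin k → Fin k → Bool) → Matrix k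
matrix g = tabulate λ a → tabulate (g a)

entry-matrix : (g : Fin k → Fin k → Bool) (a b : Fin k) → entry (matrix g) a b ≡ g a b
entry-matrix g a b rewrite lookup∘tabulate (λ a → tabulate (g a)) a = lookup∘tabulate (g a) b

search-Matrix : Searchable (Matrix k)
search-Matrix {k} = search-Vec (search-Vec search-Bool k) k

-- normal S f s stands for: build s (a single vertex or a disjoint union), add E-edges from
-- every vertex of colour a to every vertex of colour b whenever entry S a b, then recolour
-- every colour a to lookup f a simultaneously.  Here d bounds the nesting depth of unions
-- and n is the number of vertices, so there are finitely many normal forms for each d.
data Shape (k : ℕ) : ℕ → ℕ → Set
data Normal (k d n : ℕ) : Set where
  normal : Matrix k → Vec (Fin k) k → Shape k d n → Normal k d n

data Shape k where
  single : Fin k → Shape k d 1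
  union  : Normal k d m → Normal k d n → Shape k (suc d) (m + n)

colour      : Normal k d n → Fin n → Fin k
shapeColour : Shape k d n → Fin n → Fin k
colour (normal _ f s) u = lookup f (shapeColour s u)
shapeColour (single c)            _ = c
shapeColour (union {m = m} x y)   u = [ colour x , colour y ]′ (splitAt m u)

adjacent      : Normal k d n → Fin n → Fin n → Set
shapeAdjacent : Shape k d n → Fin n → Fin n → Set
adjacent (normal S _ s) u v = shapeAdjacent s u v ⊎ T (entry S (shapeColour s u) (shapeColour s v))
shapeAdjacent (single _)          _ _ = ⊥
shapeAdjacent (union {m = m} x y) u v = Pointwise (adjacent x) (adjacent y) (splitAt m u) (splitAt m v)

adjacent?      : (t : Normal k d n) → Decidable₂ (adjacent t)
shapeAdjacent? : (s : Shape k d n) → Decidable₂ (shapeAdjacent s)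
adjacent? (normal S _ s) u v = shapeAdjacent? s u v ⊎-dec T? _
shapeAdjacent? (single _)  _ _ = no λ ()
shapeAdjacent? (union x y) u v = ⊎-decidable (adjacent? x) (adjacent? y) _ _

search-Normal : ∀ d → Searchable (∃ (Normal k d))
search-Shape  : ∀ d → Searchable (∃ (Shape k d))
search-Normal d =
  search-image (search-× search-Matrix (search-× (search-Vec Fin.any? _) (search-Shape d)))
    (λ (S , f , n , s) → n , normal S f s)
    (λ { (n , normal S f s) → (S , f , n , s) , refl })
search-Shape zero = search-image Fin.any? (λ c → 1 , single c) (λ { (_ , single c) → c , refl })
search-Shape (suc d) =
  search-image (search-⊎ Fin.any? (search-× (search-Normal d) (search-Normal d)))
    [ (λ c → 1 , single c) , (λ ((m , x) , (n , y)) → m + n , union x y) ]′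
    (λ { (_ , single c) → inj₁ c , refl ; (_ , union x y) → inj₂ ((_ , x) , (_ , y)) , refl })

addEdges : Fin k → Fin k → Normal k d n → Normal k d n
addEdges i j (normal S f s) =
  normal (matrix λ a b → entry S a b ∨ (⌊ lookup f a ≟ i ⌋ ∧ ⌊ lookup f b ≟ j ⌋)) f s

addRename : Fin k → Fin k → Normal k d n → Normal k d n
addRename i j (normal S f s) = normal S (map (recolour i j) f) s

colour-addEdges : (i j : Fin k) (t : Normal k d n) (u : Fin n) → colour (addEdges i j t) u ≡ colour t u
colour-addEdges i j (normal S f s) u = refl

colour-addRename : (i j : Fin k) (t : Normal k d n) (u : Fin n) →
                   colour (addRename i j t) u ≡ recolour i j (colour t u)
colour-addRename i j (normal S f s) u = lookup-map (shapeColour s u) (recolour i j) f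

adjacent-addRename : (i j : Fin k) (t : Normal k d n) (u v : Fin n) → adjacent (addRename i j t) u v ≡ adjacent t u v
adjacent-addRename i j (normal S f s) u v = refl

adjacent-addEdges : (i j : Fin k) (t : Normal k d n) (u v : Fin n) →
                    adjacent (addEdges i j t) u v ⇔ (adjacent t u v ⊎ (colour t u ≡ i × colour t v ≡ j))
adjacent-addEdges i j (normal S f s) u v
  rewrite entry-matrix (λ a b → entry S a b ∨ (⌊ lookup f a ≟ i ⌋ ∧ ⌊ lookup f b ≟ j ⌋))
                       (shapeColour s u) (shapeColour s v) =
  ⇔.trans (⇔.refl ⊎-⇔ ⇔.trans T-∨ (⇔.refl ⊎-⇔ ⇔.trans T-∧ (T-≟ ×-⇔ T-≟)))
          (⇔.sym (↔⇒⇔ (⊎-assoc 0ℓ _ _ _)))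
  where
  T-≟ : {a b : Fin k} → T ⌊ a ≟ b ⌋ ⇔ a ≡ b
  T-≟ = mk⇔ toWitness fromWitness

noEdges : Matrix k
noEdges = matrix λ _ _ → false

normalise : (e : CE SigE k) → size e ≤ suc d → Normal k d (size e)
normalise (leaf c) _ = normal noEdges (allFin _) (single c)
normalise {d = zero}  (e₁ ⊕ e₂) ≤1 = ⊥-elim (union-not-single e₁ e₂ ≤1)
normalise {d = suc d} (e₁ ⊕ e₂) ≤2+d =
  normal noEdges (allFin _)
    (union (normalise e₁ (proj₁ (union-bounds e₁ e₂ ≤2+d))) (normalise e₂ (proj₂ (union-bounds e₁ e₂ ≤2+d))))
normalise (edge E i j e) ≤1+d = addEdges i j (normalise e ≤1+d)
normalise (rename i j e) ≤1+d = addRename i j (normalise e ≤1+d)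

no-noEdges : (a b : Fin k) → ¬ T (entry noEdges a b)
no-noEdges a b rewrite entry-matrix (λ _ _ → false) a b = λ ()

colour-normalise : (e : CE SigE k) (≤1+d : size e ≤ suc d) (u : Fin (size e)) → colour (normalise e ≤1+d) u ≡ col e u
colour-normalise (leaf c) _ _ = lookup∘tabulate id c
colour-normalise {d = zero} (e₁ ⊕ e₂) ≤1 = ⊥-elim (union-not-single e₁ e₂ ≤1)
colour-normalise {d = suc d} (e₁ ⊕ e₂) ≤2+d u with splitAt (size e₁) u
... | inj₁ x = trans (lookup∘tabulate id (colour (normalise e₁ _) x)) (colour-normalise e₁ _ x)
... | inj₂ y = trans (lookup∘tabulate id (colour (normalise e₂ _) y)) (colour-normalise e₂ _ y)
colour-normalise (edge E i j e) ≤1+d u = trans (colour-addEdges i j (normalise e ≤1+d) u) (colour-normalise e ≤1+d u)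
colour-normalise (rename i j e) ≤1+d u = begin
  colour (addRename i j (normalise e ≤1+d)) u  ≡⟨ colour-addRename i j (normalise e ≤1+d) u ⟩
  recolour i j (colour (normalise e ≤1+d) u)   ≡⟨ cong (recolour i j) (colour-normalise e ≤1+d u) ⟩
  recolour i j (col e u)                       ≡⟨ col-rename i j e u ⟨
  col (rename i j e) u                         ∎
  where open ≡-Reasoning

adjacent-normalise : (e : CE SigE k) (≤1+d : size e ≤ suc d) (u v : Fin (size e)) →
                     adjacent (normalise e ≤1+d) u v ⇔ rel e E u v
adjacent-normalise (leaf c) _ _ _ = mk⇔ [ id , no-noEdges c c ]′ λ ()
adjacent-normalise {d = zero} (e₁ ⊕ e₂) ≤1 = ⊥-elim (union-not-single e₁ e₂ ≤1)
adjacent-normalise {d = suc d} (e₁ ⊕ e₂) ≤2+d u v =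
  ⇔.trans (drop-absurdʳ (no-noEdges (shapeColour s u) (shapeColour s v))) union-adjacent
  where
  bounds = union-bounds e₁ e₂ ≤2+d
  s = union (normalise e₁ (proj₁ bounds)) (normalise e₂ (proj₂ bounds))
  union-adjacent : shapeAdjacent s u v ⇔ rel (e₁ ⊕ e₂) E u v
  union-adjacent with splitAt (size e₁) u | splitAt (size e₁) v
  ... | inj₁ x | inj₁ y = ⇔.trans (mk⇔ drop-inj₁ inj₁) (adjacent-normalise e₁ _ x y)
  ... | inj₂ x | inj₂ y = ⇔.trans (mk⇔ drop-inj₂ inj₂) (adjacent-normalise e₂ _ x y)
  ... | inj₁ _ | inj₂ _ = mk⇔ (λ ()) (λ ())
  ... | inj₂ _ | inj₁ _ = mk⇔ (λ ()) (λ ())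
adjacent-normalise (edge E i j e) ≤1+d u v
  rewrite sym (colour-normalise e ≤1+d u) | sym (colour-normalise e ≤1+d v) =
  ⇔.trans (adjacent-addEdges i j (normalise e ≤1+d) u v) (adjacent-normalise e ≤1+d u v ⊎-⇔ mk⇔ (refl ,_) proj₂)
adjacent-normalise (rename i j e) ≤1+d u v
  rewrite adjacent-addRename i j (normalise e ≤1+d) u v = adjacent-normalise e ≤1+d u v

-- The isomorphism is a pair of vectors rather than a _↔_ so that it can be searched for.
GeneratesGraph : Normal k d n → Graph → Set
GeneratesGraph {n = n} t G =
  Σ (Vec (Fin N) n) λ π → Σ (Vec (Fin n) N) λ ρ →
    (∀ u → lookup ρ (lookup π u) ≡ u) × (∀ x → lookup π (lookup ρ x) ≡ x) ×
    (∀ u v → adjacent t u v ⇔ Graph.adj G (lookup π u) (lookup π v) ≡ true)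
  where N = Graph.n G

generatesGraph? : (t : Normal k d n) (G : Graph) → Dec (GeneratesGraph t G)
generatesGraph? {n = n} t G =
  search-Vec Fin.any? n λ π → search-Vec Fin.any? (Graph.n G) λ ρ →
    Fin.all? (λ u → lookup ρ (lookup π u) ≟ u) ×-dec Fin.all? (λ x → lookup π (lookup ρ x) ≟ x) ×-dec
    Fin.all? (λ u → Fin.all? λ v → adjacent? t u v ⇔? (Graph.adj G (lookup π u) (lookup π v) Bool.≟ true))

GeneratingNormal : ℕ → Graph → Set
GeneratingNormal k G = ∃ λ ((_ , t) : ∃ (Normal k (Graph.n G))) → GeneratesGraph t G

search-generating-normal : (G : Graph) → Dec (GeneratingNormal k G)
search-generating-normal G = search-Normal _ λ (_ , t) → generatesGraph? t G

generating-normal : (G : Graph) → CWAtMost G k → GeneratingNormal k G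
generating-normal G (e , e≅G) =
  (size e , normalise e size≤1+N) , tabulate to , tabulate from , from-to , to-from , adjacency
  where
  open _≅_ e≅G
  open Inverse bij
  size≤1+N : size e ≤ suc (Graph.n G)
  size≤1+N = ℕ.m≤n⇒m≤1+n (Fin.injective⇒≤ (Injection.injective (↔⇒↣ bij)))
  from-to : ∀ u → lookup (tabulate from) (lookup (tabulate to) u) ≡ u
  from-to u rewrite lookup∘tabulate to u | lookup∘tabulate from (to u) = strictlyInverseʳ u
  to-from : ∀ x → lookup (tabulate to) (lookup (tabulate from) x) ≡ x
  to-from x rewrite lookup∘tabulate from x | lookup∘tabulate to (from x) = strictlyInverseˡ x
  adjacency : ∀ u v → adjacent (normalise e size≤1+N) u v
                      ⇔ Graph.adj G (lookup (tabulate to) u) (lookup (tabulate to) v) ≡ true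
  adjacency u v rewrite lookup∘tabulate to u | lookup∘tabulate to v = ⇔.trans (adjacent-normalise e size≤1+N u v) (pres E u v)

-- Clique-expressions of ordered graphs

↑ˡ<↑ʳ : (i : Fin m) (j : Fin n) → i ↑ˡ n Fin.< m ↑ʳ j
↑ˡ<↑ʳ {m} {n} i j =
  subst₂ ℕ._<_ (sym (Fin.toℕ-↑ˡ i n)) (sym (Fin.toℕ-↑ʳ m j)) (ℕ.<-≤-trans (Fin.toℕ<n i) (ℕ.m≤m+n m _))

join-< : (s t : Fin m ⊎ Fin n) → Fin.join m n s Fin.< Fin.join m n t ⇔ (Fin._<_ ⊎-< Fin._<_) s t
join-< {m} {n} (inj₁ i) (inj₁ j) =
  mk⇔ (₁∼₁ ∘ subst₂ ℕ._<_ (Fin.toℕ-↑ˡ i n) (Fin.toℕ-↑ˡ j n))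
      (subst₂ ℕ._<_ (sym (Fin.toℕ-↑ˡ i n)) (sym (Fin.toℕ-↑ˡ j n)) ∘ LeftOrder.drop-inj₁)
join-< {m} {n} (inj₂ i) (inj₂ j) =
  mk⇔ (₂∼₂ ∘ ℕ.+-cancelˡ-< m _ _ ∘ subst₂ ℕ._<_ (Fin.toℕ-↑ʳ m i) (Fin.toℕ-↑ʳ m j))
      (subst₂ ℕ._<_ (sym (Fin.toℕ-↑ʳ m i)) (sym (Fin.toℕ-↑ʳ m j)) ∘ ℕ.+-monoʳ-< m ∘ LeftOrder.drop-inj₂)
join-< (inj₁ i) (inj₂ j) = mk⇔ (λ _ → ₁∼₂) (λ _ → ↑ˡ<↑ʳ i j)
join-< (inj₂ i) (inj₁ j) = mk⇔ (λ i<j → ⊥-elim (Fin.<-asym i<j (↑ˡ<↑ʳ j i))) (λ ())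

record Represents (X : CE SigE< w) (κ : Fin n → Fin w) (ρ : Fin n → Fin n → Set) : Set where
  field
    vertices : Fin (size X) ↔ Fin n
    col-to   : ∀ u → col X u ≡ κ (Inverse.to vertices u)
    E-to     : ∀ u v → rel X E' u v ⇔ ρ (Inverse.to vertices u) (Inverse.to vertices v)
    lt-to    : ∀ u v → rel X lt u v ⇔ Inverse.to vertices u Fin.< Inverse.to vertices v

  φ : Fin (size X) → Fin n
  φ = Inverse.to vertices

record Palette (k w : ℕ) : Set where
  field
    c₀ c₁     : Fin k → Fin w
    decode    : Fin w → Maybe (Fin k ⊎ Fin k)
    decode-c₀ : ∀ a → decode (c₀ a) ≡ just (inj₁ a)
    decode-c₁ : ∀ a → decode (c₁ a) ≡ just (inj₂ a)

module Ordered (P : Palette k w) where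
  open Palette P

  c₀-injective : Injective _≡_ _≡_ c₀
  c₀-injective {a} {b} c₀a≡c₀b =
    Sum.inj₁-injective (Maybe.just-injective (trans (sym (decode-c₀ a)) (trans (cong decode c₀a≡c₀b) (decode-c₀ b))))

  c₁-injective : Injective _≡_ _≡_ c₁
  c₁-injective {a} {b} c₁a≡c₁b =
    Sum.inj₂-injective (Maybe.just-injective (trans (sym (decode-c₁ a)) (trans (cong decode c₁a≡c₁b) (decode-c₁ b))))

  c₀≢c₁ : ∀ a b → c₀ a ≢ c₁ b
  c₀≢c₁ a b c₀a≡c₁b with trans (sym (decode-c₀ a)) (trans (cong decode c₀a≡c₁b) (decode-c₁ b))
  ... | ()

  c₁≢c₀ : ∀ a b → c₁ a ≢ c₀ b
  c₁≢c₀ a b = c₀≢c₁ b a ∘ sym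

  c₀→c₁ : Fin w → Fin w → Bool
  c₀→c₁ x y with decode x | decode y
  ... | just (inj₁ _) | just (inj₂ _) = true
  ... | _             | _             = false

  c₀-matrix : Matrix k → Fin w → Fin w → Bool
  c₀-matrix S x y with decode x | decode y
  ... | just (inj₁ a) | just (inj₁ b) = entry S a b
  ... | _             | _             = false

  c₀→c₁-c₀c₁ : ∀ a b → T (c₀→c₁ (c₀ a) (c₁ b))
  c₀→c₁-c₀c₁ a b rewrite decode-c₀ a | decode-c₁ b = _

  c₀→c₁-to-c₀ : ∀ x b → ¬ T (c₀→c₁ x (c₀ b))
  c₀→c₁-to-c₀ x b rewrite decode-c₀ b with decode x
  ... | just (inj₁ _) = λ ()
  ... | just (inj₂ _) = λ ()
  ... | nothing       = λ ()

  c₀→c₁-from-c₁ : ∀ a y → ¬ T (c₀→c₁ (c₁ a) y)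
  c₀→c₁-from-c₁ a y rewrite decode-c₁ a = λ ()

  c₀-matrix-c₀ : ∀ S a b → c₀-matrix S (c₀ a) (c₀ b) ≡ entry S a b
  c₀-matrix-c₀ S a b rewrite decode-c₀ a | decode-c₀ b = refl

  shiftUp : List (Fin w × Fin w)
  shiftUp = relabel c₀ c₁

  shiftDown : (Fin k → Fin k) → List (Fin w × Fin w)
  shiftDown g = relabel c₁ (c₀ ∘ g)

  recolourAll-shiftUp : ∀ a → recolourAll shiftUp (c₀ a) ≡ c₁ a
  recolourAll-shiftUp = recolourAll-relabel c₀ c₁ c₀-injective c₁≢c₀

  recolourAll-shiftDown : ∀ g a → recolourAll (shiftDown g) (c₁ a) ≡ c₀ (g a)
  recolourAll-shiftDown g = recolourAll-relabel c₁ (c₀ ∘ g) c₁-injective (λ a → c₀≢c₁ (g a))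

  recolourAll-shiftDown-c₀ : ∀ g a → recolourAll (shiftDown g) (c₀ a) ≡ c₀ a
  recolourAll-shiftDown-c₀ g a = recolourAll-relabel-outside c₁ (c₀ ∘ g) (c₀≢c₁ a)

  -- Renames act on one colour at a time, so the simultaneous recolouring passes through c₁.
  edgesThenRecolour : Matrix k → Vec (Fin k) k → CE SigE< w → CE SigE< w
  edgesThenRecolour S f X = renames (shiftDown (lookup f)) ◃ renames shiftUp ◃ edges E' (pairsWhere (c₀-matrix S)) ◃ X

  -- Parking B in c₁ makes the <-edges go exactly from the vertices of A to those of B.
  orderedUnion : CE SigE< w → CE SigE< w → CE SigE< w
  orderedUnion A B = renames (shiftDown id) ◃ edges lt (pairsWhere c₀→c₁) ◃ (A ⊕ (renames shiftUp ◃ B))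

  ordered      : Normal k d n → CE SigE< w
  orderedShape : Shape k d n → CE SigE< w
  ordered (normal S f s) = edgesThenRecolour S f (orderedShape s)
  orderedShape (single c)  = leaf (c₀ c)
  orderedShape (union x y) = orderedUnion (ordered x) (ordered y)


  represents-leaf : ∀ c → Represents (leaf (c₀ c)) (λ _ → c₀ c) (λ _ _ → ⊥)
  represents-leaf c = record
    { vertices = ↔-refl
    ; col-to   = λ _ → refl
    ; E-to     = λ _ _ → mk⇔ (λ ()) (λ ())
    ; lt-to    = λ { zero zero → mk⇔ (λ ()) (λ ()) }
    }

  represents-edgesThenRecolour : ∀ S f {X : CE SigE< w} {κ : Fin n → Fin k} {ρ : Fin n → Fin n → Set} →
    Represents X (c₀ ∘ κ) ρ →
    Represents (edgesThenRecolour S f X) (c₀ ∘ lookup f ∘ κ) (λ u v → ρ u v ⊎ T (entry S (κ u) (κ v)))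
  represents-edgesThenRecolour {n = n} S f {X} {κ} {ρ} RX =
    record { vertices = vertices ; col-to = col-to ; E-to = E-to ; lt-to = lt-to }
    where
    module RX = Represents RX
    addS : List (Unary SigE< w)
    addS = edges E' (pairsWhere (c₀-matrix S))
    down : List (Fin w × Fin w)
    down = shiftDown (lookup f)
    Y₁ Y₂ : CE SigE< w
    Y₁ = addS ◃ X
    Y₂ = renames shiftUp ◃ Y₁
    σ₁ : Fin (size Y₁) → Fin (size X)
    σ₁ = ◃-vertex addS X
    σ₂ : Fin (size Y₂) → Fin (size Y₁)
    σ₂ = ◃-vertex (renames shiftUp) Y₁
    σ₃ : Fin (size (edgesThenRecolour S f X)) → Fin (size Y₂)
    σ₃ = ◃-vertex (renames down) Y₂
    τ : Fin (size (edgesThenRecolour S f X)) → Fin (size X)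
    τ = σ₁ ∘ σ₂ ∘ σ₃
    vertices : Fin (size (edgesThenRecolour S f X)) ↔ Fin n
    vertices = ↔-trans (◃-vertices (renames down) Y₂)
                 (↔-trans (◃-vertices (renames shiftUp) Y₁) (↔-trans (◃-vertices addS X) RX.vertices))
    φ : Fin (size (edgesThenRecolour S f X)) → Fin n
    φ = Inverse.to vertices
    col-to : ∀ u → col (edgesThenRecolour S f X) u ≡ c₀ (lookup f (κ (φ u)))
    col-to u = begin
      col (edgesThenRecolour S f X) u                              ≡⟨ col-renames Y₂ down u ⟩
      recolourAll down (col Y₂ (σ₃ u))                             ≡⟨ cong (recolourAll down) (col-renames Y₁ shiftUp (σ₃ u)) ⟩
      recolourAll down (recolourAll shiftUp (col Y₁ (σ₂ (σ₃ u))))  ≡⟨ cong (recolourAll down ∘ recolourAll shiftUp) col-Y₁ ⟩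
      recolourAll down (recolourAll shiftUp (c₀ (κ (φ u))))        ≡⟨ cong (recolourAll down) (recolourAll-shiftUp (κ (φ u))) ⟩
      recolourAll down (c₁ (κ (φ u)))                              ≡⟨ recolourAll-shiftDown (lookup f) (κ (φ u)) ⟩
      c₀ (lookup f (κ (φ u)))                                      ∎
      where
      open ≡-Reasoning
      col-Y₁ : col Y₁ (σ₂ (σ₃ u)) ≡ c₀ (κ (φ u))
      col-Y₁ = trans (col-edges X E' (pairsWhere (c₀-matrix S)) (σ₂ (σ₃ u))) (RX.col-to (τ u))
    S-edge : ∀ a b → (E' ≡ E' × T (c₀-matrix S (col X a) (col X b))) ⇔ T (entry S (κ (RX.φ a)) (κ (RX.φ b)))
    S-edge a b rewrite RX.col-to a | RX.col-to b | c₀-matrix-c₀ S (κ (RX.φ a)) (κ (RX.φ b)) = mk⇔ proj₂ (refl ,_)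
    E-to : ∀ u v → rel (edgesThenRecolour S f X) E' u v ⇔ (ρ (φ u) (φ v) ⊎ T (entry S (κ (φ u)) (κ (φ v))))
    E-to u v rewrite rel-renames Y₂ down E' u v | rel-renames Y₁ shiftUp E' (σ₃ u) (σ₃ v) =
      ⇔.trans (rel-edgesWhere X E' (c₀-matrix S) E' (σ₂ (σ₃ u)) (σ₂ (σ₃ v)))
              (RX.E-to (τ u) (τ v) ⊎-⇔ S-edge (τ u) (τ v))
    lt-to : ∀ u v → rel (edgesThenRecolour S f X) lt u v ⇔ φ u Fin.< φ v
    lt-to u v rewrite rel-renames Y₂ down lt u v | rel-renames Y₁ shiftUp lt (σ₃ u) (σ₃ v) =
      ⇔.trans (rel-edgesWhere X E' (c₀-matrix S) lt (σ₂ (σ₃ u)) (σ₂ (σ₃ v)))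
              (⇔.trans (drop-absurdʳ λ ()) (RX.lt-to (τ u) (τ v)))

  represents-orderedUnion : {A B : CE SigE< w} {κ₁ : Fin m → Fin k} {κ₂ : Fin n → Fin k}
    {ρ₁ : Fin m → Fin m → Set} {ρ₂ : Fin n → Fin n → Set} →
    Represents A (c₀ ∘ κ₁) ρ₁ → Represents B (c₀ ∘ κ₂) ρ₂ →
    Represents (orderedUnion A B) (c₀ ∘ [ κ₁ , κ₂ ]′ ∘ splitAt m)
               (λ u v → Pointwise ρ₁ ρ₂ (splitAt m u) (splitAt m v))
  represents-orderedUnion {m = m} {n = n} {A = A} {B} {κ₁} {κ₂} {ρ₁} {ρ₂} RA RB =
    record { vertices = vertices ; col-to = col-to ; E-to = E-to ; lt-to = lt-to }
    where
    module RA = Represents RA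
    module RB = Represents RB
    addLt : List (Unary SigE< w)
    addLt = edges lt (pairsWhere c₀→c₁)
    B′ U Y : CE SigE< w
    B′ = renames shiftUp ◃ B
    U = A ⊕ B′
    Y = addLt ◃ U
    σB : Fin (size B′) → Fin (size B)
    σB = ◃-vertex (renames shiftUp) B
    σ : Fin (size (orderedUnion A B)) → Fin (size U)
    σ = ◃-vertex addLt U ∘ ◃-vertex (renames (shiftDown id)) Y
    side : Fin (size U) → Fin m ⊎ Fin n
    side w = Sum.map RA.φ (RB.φ ∘ σB) (splitAt (size A) w)
    vertices : Fin (size (orderedUnion A B)) ↔ Fin (m + n)
    vertices = ↔-trans (◃-vertices (renames (shiftDown id)) Y) (↔-trans (◃-vertices addLt U)
                 (↔-trans Fin.+↔⊎
                   (↔-trans (RA.vertices ⊎-↔ ↔-trans (◃-vertices (renames shiftUp) B) RB.vertices) (↔-sym Fin.+↔⊎))))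
    φ : Fin (size (orderedUnion A B)) → Fin (m + n)
    φ = Inverse.to vertices
    splitAt-φ : ∀ u → splitAt m (φ u) ≡ side (σ u)
    splitAt-φ u = Fin.splitAt-join m n (side (σ u))
    col-B′ : ∀ y → col B′ y ≡ c₁ (κ₂ (RB.φ (σB y)))
    col-B′ y = trans (col-renames B shiftUp y) (trans (cong (recolourAll shiftUp) (RB.col-to (σB y))) (recolourAll-shiftUp _))
    col-side : ∀ w → recolourAll (shiftDown id) (col U w) ≡ c₀ ([ κ₁ , κ₂ ]′ (side w))
    col-side w with splitAt (size A) w
    ... | inj₁ x rewrite RA.col-to x = recolourAll-shiftDown-c₀ id _
    ... | inj₂ y rewrite col-B′ y    = recolourAll-shiftDown id _
    E-side : ∀ w z → rel U E' w z ⇔ Pointwise ρ₁ ρ₂ (side w) (side z)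
    E-side w z with splitAt (size A) w | splitAt (size A) z
    ... | inj₁ x | inj₁ y = ⇔.trans (RA.E-to x y) (mk⇔ inj₁ drop-inj₁)
    ... | inj₂ x | inj₂ y rewrite rel-renames B shiftUp E' x y = ⇔.trans (RB.E-to (σB x) (σB y)) (mk⇔ inj₂ drop-inj₂)
    ... | inj₁ _ | inj₂ _ = mk⇔ (λ ()) (λ ())
    ... | inj₂ _ | inj₁ _ = mk⇔ (λ ()) (λ ())
    lt-side : ∀ w z → (rel U lt w z ⊎ (lt ≡ lt × T (c₀→c₁ (col U w) (col U z))))
                      ⇔ (Fin._<_ ⊎-< Fin._<_) (side w) (side z)
    lt-side w z with splitAt (size A) w | splitAt (size A) z
    ... | inj₁ x | inj₁ y rewrite RA.col-to y =
      ⇔.trans (drop-absurdʳ (c₀→c₁-to-c₀ (col A x) _ ∘ proj₂))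
              (⇔.trans (RA.lt-to x y) (mk⇔ ₁∼₁ LeftOrder.drop-inj₁))
    ... | inj₂ x | inj₂ y rewrite col-B′ x | rel-renames B shiftUp lt x y =
      ⇔.trans (drop-absurdʳ (c₀→c₁-from-c₁ _ (col B′ y) ∘ proj₂))
              (⇔.trans (RB.lt-to (σB x) (σB y)) (mk⇔ ₂∼₂ LeftOrder.drop-inj₂))
    ... | inj₁ x | inj₂ y rewrite RA.col-to x | col-B′ y = mk⇔ (λ _ → ₁∼₂) (λ _ → inj₂ (refl , c₀→c₁-c₀c₁ _ _))
    ... | inj₂ x | inj₁ y rewrite col-B′ x = mk⇔ [ (λ ()) , ⊥-elim ∘ c₀→c₁-from-c₁ _ (col A y) ∘ proj₂ ]′ (λ ())
    col-to : ∀ u → col (orderedUnion A B) u ≡ c₀ ([ κ₁ , κ₂ ]′ (splitAt m (φ u)))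
    col-to u rewrite splitAt-φ u | col-renames Y (shiftDown id) u
                   | col-edges U lt (pairsWhere c₀→c₁) (◃-vertex (renames (shiftDown id)) Y u) =
      col-side (σ u)
    E-to : ∀ u v → rel (orderedUnion A B) E' u v ⇔ Pointwise ρ₁ ρ₂ (splitAt m (φ u)) (splitAt m (φ v))
    E-to u v rewrite rel-renames Y (shiftDown id) E' u v | splitAt-φ u | splitAt-φ v =
      ⇔.trans (rel-edgesWhere U lt c₀→c₁ E' _ _) (⇔.trans (drop-absurdʳ λ { (() , _) }) (E-side (σ u) (σ v)))
    lt-to : ∀ u v → rel (orderedUnion A B) lt u v ⇔ φ u Fin.< φ v
    lt-to u v rewrite rel-renames Y (shiftDown id) lt u v =
      ⇔.trans (rel-edgesWhere U lt c₀→c₁ lt _ _) (⇔.trans (lt-side (σ u) (σ v)) (⇔.sym (join-< (side (σ u)) (side (σ v)))))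

  represents-ordered      : (t : Normal k d n) → Represents (ordered t) (c₀ ∘ colour t) (adjacent t)
  represents-orderedShape : (s : Shape k d n) → Represents (orderedShape s) (c₀ ∘ shapeColour s) (shapeAdjacent s)
  represents-ordered (normal S f s) = represents-edgesThenRecolour S f (represents-orderedShape s)
  represents-orderedShape (single c)  = represents-leaf c
  represents-orderedShape (union x y) = represents-orderedUnion (represents-ordered x) (represents-ordered y)

palette : k + k ≤ w → Palette k w
palette {k} {w} k+k≤w = record
  { c₀ = λ a → Fin.inject≤ (a ↑ˡ k) k+k≤w
  ; c₁ = λ a → Fin.inject≤ (k ↑ʳ a) k+k≤w
  ; decode = decode
  ; decode-c₀ = λ a → trans (decode-inject≤ (a ↑ˡ k)) (cong just (Fin.splitAt-↑ˡ k a k))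
  ; decode-c₁ = λ a → trans (decode-inject≤ (k ↑ʳ a)) (cong just (Fin.splitAt-↑ʳ k k a))
  }
  where
  decode : Fin w → Maybe (Fin k ⊎ Fin k)
  decode x with Fin.toℕ x ℕ.<? k + k
  ... | yes x<k+k = just (splitAt k (Fin.fromℕ< x<k+k))
  ... | no  _     = nothing
  decode-inject≤ : ∀ y → decode (Fin.inject≤ y k+k≤w) ≡ just (splitAt k y)
  decode-inject≤ y with Fin.toℕ (Fin.inject≤ y k+k≤w) ℕ.<? k + k
  ... | yes y<k+k = cong (just ∘ splitAt k) (Fin.toℕ-injective (trans (Fin.toℕ-fromℕ< y<k+k) (Fin.toℕ-inject≤ y k+k≤w)))
  ... | no  y≮k+k = ⊥-elim (y≮k+k (subst (ℕ._< k + k) (sym (Fin.toℕ-inject≤ y k+k≤w)) (Fin.toℕ<n y)))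

n<2^n : ∀ n → n < 2 ^ n
n<2^n zero    = ℕ.s≤s ℕ.z≤n
n<2^n (suc n) = begin-strict
  suc n          ≤⟨ n<2^n n ⟩
  2 ^ n          <⟨ ℕ.m<m+n (2 ^ n) (ℕ.m^n>0 2 n) ⟩
  2 ^ n + 2 ^ n  ≡⟨ cong (2 ^ n +_) (ℕ.+-identityʳ (2 ^ n)) ⟨
  2 ^ suc n      ∎
  where open ℕ.≤-Reasoning

k+k≤2^[k+2] : ∀ k → k + k ≤ 2 ^ (k + 2)
k+k≤2^[k+2] k = begin
  k + k          ≤⟨ ℕ.+-mono-≤ (ℕ.<⇒≤ (n<2^n k)) (ℕ.<⇒≤ (n<2^n k)) ⟩
  2 ^ k + 2 ^ k  ≡⟨ cong (2 ^ k +_) (ℕ.+-identityʳ (2 ^ k)) ⟨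
  2 ^ suc k      ≤⟨ ℕ.^-monoʳ-≤ 2 (ℕ.≤-trans (ℕ.n≤1+n (suc k)) (ℕ.≤-reflexive (ℕ.+-comm 2 k))) ⟩
  2 ^ (k + 2)    ∎
  where open ℕ.≤-Reasoning

pullback-isStrictTotalOrder : (f : A → Fin n) → Injective _≡_ _≡_ f → IsStrictTotalOrder _≡_ (λ x y → f x Fin.< f y)
pullback-isStrictTotalOrder f f-injective = record
  { isStrictPartialOrder = record
    { isEquivalence = ≡.isEquivalence
    ; irrefl        = λ { refl → Fin.<-irrefl refl }
    ; trans         = Fin.<-trans
    ; <-resp-≈      = (λ { refl fx<fy → fx<fy }) , (λ { refl fy<fx → fy<fx })
    }
  ; compare = compare
  }
  where
  compare : Trichotomous _≡_ (λ x y → f x Fin.< f y)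
  compare x y with Fin.<-cmp (f x) (f y)
  ... | tri< fx<fy fx≢fy fx≯fy = tri< fx<fy (fx≢fy ∘ cong f) fx≯fy
  ... | tri≈ fx≮fy fx≡fy fx≯fy = tri≈ fx≮fy (f-injective fx≡fy) fx≯fy
  ... | tri> fx≮fy fx≢fy fx>fy = tri> fx≮fy (fx≢fy ∘ cong f) fx>fy

OrderedExpression : Graph → ℕ → Set₁
OrderedExpression G w = Σ (Fin (Graph.n G) → Fin (Graph.n G) → Set) λ _<_ →
                          IsStrictTotalOrder _≡_ _<_ × Σ (CE SigE< w) λ e → Generates e (ordGraphStr G _<_)

ordered-expression : {G : Graph} → Palette k w → GeneratingNormal k G → OrderedExpression G w
ordered-expression {G = G} P ((n , t) , π , ρ , ρπ , πρ , adjacency) =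
  _≺_ , pullback-isStrictTotalOrder (lookup ρ) ρ-injective , ordered t , record { bij = bij ; pres = pres }
  where
  open Ordered P
  open Represents (represents-ordered t)
  relabelling : Fin n ↔ Fin (Graph.n G)
  relabelling = mk↔ₛ′ (lookup π) (lookup ρ) πρ ρπ
  _≺_ : Fin (Graph.n G) → Fin (Graph.n G) → Set
  x ≺ y = lookup ρ x Fin.< lookup ρ y
  ρ-injective : Injective _≡_ _≡_ (lookup ρ)
  ρ-injective = Injection.injective (↔⇒↣ (↔-sym relabelling))
  bij : Fin (size (ordered t)) ↔ Fin (Graph.n G)
  bij = ↔-trans vertices relabelling
  pres : ∀ R u v → rel (ordered t) R u v ⇔ Str.Rel (ordGraphStr G _≺_) R (Inverse.to bij u) (Inverse.to bij v)
  pres E' u v = ⇔.trans (E-to u v) (adjacency (φ u) (φ v))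
  pres lt u v rewrite ρπ (φ u) | ρπ (φ v) = lt-to u v

lemma4p7 : (k : ℕ) (G : Graph) → .(CWAtMost G k) →
    Σ (Fin (Graph.n G) → Fin (Graph.n G) → Set) λ _<_ →
      IsStrictTotalOrder _≡_ _<_ ×
      Σ (CE SigE< (2 ^ (k + 2))) λ e → Generates e (ordGraphStr G _<_)
lemma4p7 k G cw with search-generating-normal {k} G
... | yes generating = ordered-expression (palette (k+k≤2^[k+2] k)) generating
... | no  none       = Irr.⊥-elim (none (generating-normal G cw))
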